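{- Let $u\le v$ be integers and $B\subseteq[u,v]$ a set of integers. \begin{enumerate} \item $B$ is anti-symmetric in $[u,v]$ if and only if $B$ is half dense in $[u,v]$ and $u+v\notin 2B$. \item If $B$ is left dense in $[u,v]$ and $v-u>1$, then $u,u+1\in B$ and $v,v-1\notin B$. \item If $B$ is left dense in $[u,v]$, then $2(B\cup\{v+1\})\supseteq[2u,u+v-1]\cup(v+1+(B\cup\{v+1\}))$. \item If $B$ is left dense in $[u,v]$, then $|2(B\cup\{v+1\})|=3|B\cup\{v+1\}|-3$ if and only if $B$ is anti-symmetric and additively minimal in $[u,v]$. \item If $B$ is left dense in $[u,v]$, then either $B$ is the interval $[u,\frac12(u+v-1)]$, or $|2(B\cup\{b\})|>3|B\cup\{b\}|-3$ for every integer $b>v+1$. \item Let $n,u$ be integers with $u\in[4,n-6]$. If $C$ is right dense, anti-symmetric and additively minimal in $[1,u]$, and $D$ is left dense, anti-symmetric and additively minimal in $[u+2,n-1]$, then $|2(\{0\}\cup C\cup D\cup\{n\})|=3|\{0\}\cup C\cup D\cup\{n\}|-3$. \end{enumerate}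
   Context: $2X=\{x+x':x,x'\in X\}$, $t+X=\{t+x:x\in X\}$, $t-X=\{t-x:x\in X\}$. For integers $a\le b$, $[a,b]$ is the set of integers between $a$ and $b$ inclusive (empty if $a>b$), and $X(a,b)=|X\cap[a,b]|$. For $B\subseteq[u,v]$: $B$ is half dense in $[u,v]$ if $B(u,v)=\frac12(v-u+1)$; $B$ is anti-symmetric in $[u,v]$ if $B\cap(u+v-B)=\emptyset$ and $B\cup(u+v-B)=[u,v]$; a half dense $B$ is left dense in $[u,v]$ if $B(u,x)>\frac12(x-u+1)$ for all $x\in[u,v-1]$, and right dense in $[u,v]$ if $B(x,v)>\frac12(v-x+1)$ for all $x\in[u+1,v]$. A left dense anti-symmetric $B$ in $[u,v]$ is additively minimal in $[u,v]$ if $2(B\cup\{v+1\})=[2u,u+v-1]\cup(v+1+(B\cup\{v+1\}))$; a right dense anti-symmetric $B$ in $[u,v]$ is additively minimal in $[u,v]$ if $2(B\cup\{u-1\})=[u+v+1,2v]\cup(u-1+(B\cup\{u-1\}))$. -}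

module Defs where

open import Data.Nat using (ℕ)
open import Data.Integer using (ℤ; +_; _+_; _-_; _*_; _≤_; _<_; _≤?_)
open import Data.Integer.Properties using (_≟_)
open import Data.List using (List; []; _∷_; _++_; map; length; filter; deduplicate; cartesianProductWith)
open import Data.List.Membership.Propositional using (_∈_; _∉_)
open import Data.Product using (_×_; _,_)
open import Data.Sum using (_⊎_)
open import Function.Bundles using (_⇔_)
open import Relation.Nullary.Decidable using (_×-dec_)
open import Relation.Binary.PropositionalEquality using (_≡_)

-- Finite sets of integers are represented by lists (duplicates allowed;
-- the set is the set of list members).

card : List ℤ → ℕ
card X = length (deduplicate _≟_ X)

cnt : List ℤ → ℤ → ℤ → ℕ
cnt X a b = card (filter (λ x → (a ≤? x) ×-dec (x ≤? b)) X)

twice : List ℤ → List ℤ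
twice X = cartesianProductWith _+_ X X

shift : ℤ → List ℤ → List ℤ
shift t X = map (λ x → t + x) X

InIv : ℤ → ℤ → ℤ → Set
InIv a b x = (a ≤ x) × (x ≤ b)

SubIv : ℤ → ℤ → List ℤ → Set
SubIv u v B = ∀ x → x ∈ B → InIv u v x

HalfDense : ℤ → ℤ → List ℤ → Set
HalfDense u v B = + 2 * + cnt B u v ≡ v - u + + 1

AntiSym : ℤ → ℤ → List ℤ → Set
AntiSym u v B =
  (∀ x → x ∈ B → (u + v - x) ∉ B) ×
  (∀ x → InIv u v x → (x ∈ B) ⊎ (u + v - x ∈ B))

LeftDense : ℤ → ℤ → List ℤ → Set
LeftDense u v B =
  HalfDense u v B ×
  (∀ x → InIv u (v - + 1) x → x - u + + 1 < + 2 * + cnt B u x)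

RightDense : ℤ → ℤ → List ℤ → Set
RightDense u v B =
  HalfDense u v B ×
  (∀ x → InIv (u + + 1) v x → v - x + + 1 < + 2 * + cnt B x v)

AddMinL : ℤ → ℤ → List ℤ → Set
AddMinL u v B =
  ∀ t → (t ∈ twice (B ++ (v + + 1 ∷ [])))
        ⇔ (InIv (+ 2 * u) (u + v - + 1) t ⊎ (t ∈ shift (v + + 1) (B ++ (v + + 1 ∷ []))))

AddMinR : ℤ → ℤ → List ℤ → Set
AddMinR u v B =
  ∀ t → (t ∈ twice (B ++ (u - + 1 ∷ [])))
        ⇔ (InIv (u + v + + 1) (+ 2 * v) t ⊎ (t ∈ shift (u - + 1) (B ++ (u - + 1 ∷ []))))

-- The reflection x ↦ u + v - x pairs up [u, v]; this gives (1), and, applied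
-- to the windows [u, t - u], shows that a left dense B already has [2u, u + v - 1] ⊆ 2B (3).
-- Together with the disjoint copy b + (B ∪ {b}) this yields |2(B ∪ {b})| ≥ (v - u) + |B ∪ {b}|
-- = 3|B ∪ {b}| - 3 for every b > v; (4) is the equality case, and in (5) one of u + v,
-- u + v + 1 lies in 2B unless B is an initial segment.  In (6), 2A is the disjoint union of
-- {0} ∪ C, the interval [u + 2, n + u] and n + (D ∪ {n}): sums inside C or D are controlled by
-- additive minimality, mixed sums land in the interval, and 2u + 1, 2u + 2, 2u + 3 are
-- (u - 1) + (u + 2), u + (u + 2), u + (u + 3) with u - 1, u ∈ C and u + 2, u + 3 ∈ D.

module Submission where

open import Defs
open import Data.Nat as ℕ using (ℕ; zero; suc; z≤n; s≤s)
import Data.Nat.Properties as ℕ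
open import Data.Integer using (ℤ; +_; +≤+; +<+; -1ℤ; 0ℤ; 1ℤ; _+_; _-_; _*_; _≤_; _<_; _>_; _≤?_; ∣_∣)
open import Data.Integer.Properties
  using ( _≟_; +-comm; +-identityˡ; +-identityʳ; +-mono-≤; +-injective; 0≤i⇒+∣i∣≡i; drop‿+<+
        ; ≤-refl; ≤-reflexive; ≤-trans; <-irrefl; <⇒≤; <-≤-trans; ≤-<-trans; ≤∧≢⇒<; ≰⇒>
        ; 0≤i-j⇒j≤i; i≤j⇒0≤j-i; suc[i]≤j⇒i<j; i<j⇒suc[i]≤j; module ≤-Reasoning)
open import Data.Integer.Tactic.RingSolver using (solve; solve-∀)
open import Data.List using (List; []; _∷_; _++_; map; length; applyUpTo; deduplicate; filter)
open import Data.List.Properties using (length-++; length-map; length-applyUpTo)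
open import Data.List.Membership.Propositional using (_∈_; _∉_)
open import Data.List.Membership.Propositional.Properties
open import Data.List.Membership.DecPropositional _≟_ using (_∈?_)
open import Data.List.Relation.Binary.Subset.Propositional using (_⊆_)
open import Data.List.Relation.Binary.Disjoint.Propositional using (Disjoint)
open import Data.List.Relation.Unary.Any using (here; there)
import Data.List.Relation.Unary.All as All
open import Data.List.Relation.Unary.Unique.Propositional using (Unique; _∷_)
import Data.List.Relation.Unary.Unique.Propositional.Properties as Unique
open import Data.List.Relation.Unary.Unique.DecPropositional.Properties _≟_ using (deduplicate-!)
open import Data.Empty using (⊥; ⊥-elim)
open import Data.Product using (_×_; _,_; proj₁; proj₂; ∃₂)
open import Data.Sum using (_⊎_; inj₁; inj₂; [_,_]; map₁; map₂)
open import Function using (_∘_; id)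
open import Function.Bundles using (_⇔_; mk⇔; Equivalence)
open import Function.Definitions using (Injective)
open import Relation.Nullary using (yes; no)
open import Relation.Nullary.Decidable using (_×-dec_; decidable-stable)
open import Relation.Binary.PropositionalEquality hiding ([_])

-- Linear facts over ℤ are proved by certificates: the difference is exhibited as a sum of
-- nonnegative terms, and the identity is checked by the ring solver.

infixl 6 _⊕_

_⊕_ : ∀ {i j} → 0ℤ ≤ i → 0ℤ ≤ j → 0ℤ ≤ i + j
_⊕_ = +-mono-≤

0≤+ : ∀ n → 0ℤ ≤ + n
0≤+ n = +≤+ z≤n

0≤-by : ∀ {d e} → 0ℤ ≤ d → d ≡ e → 0ℤ ≤ e
0≤-by 0≤d refl = 0≤d

≤-by : ∀ {i j d} → 0ℤ ≤ d → d ≡ j - i → i ≤ j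
≤-by 0≤d refl = 0≤i-j⇒j≤i 0≤d

<-by : ∀ {i j d} → 0ℤ ≤ d → d ≡ j - i - 1ℤ → i < j
<-by {i} {j} 0≤d refl = suc[i]≤j⇒i<j (≤-by {1ℤ + i} {j} 0≤d (solve (i ∷ j ∷ [])))

impossible-by : ∀ {d} → 0ℤ ≤ d → d ≡ -1ℤ → ⊥
impossible-by () refl

≤⇒0≤ : ∀ {i j} → i ≤ j → 0ℤ ≤ j - i
≤⇒0≤ = i≤j⇒0≤j-i

<⇒0≤ : ∀ {i j} → i < j → 0ℤ ≤ j - i - 1ℤ
<⇒0≤ {i} {j} i<j = subst (0ℤ ≤_) j-[1+i]≡j-i-1 (≤⇒0≤ (i<j⇒suc[i]≤j i<j))
  where
  j-[1+i]≡j-i-1 : j - (1ℤ + i) ≡ j - i - 1ℤ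
  j-[1+i]≡j-i-1 = solve (i ∷ j ∷ [])

≤⇒≤+1 : ∀ {i j} → i ≤ j → i ≤ j + 1ℤ
≤⇒≤+1 {i} {j} i≤j = ≤-by (≤⇒0≤ i≤j ⊕ 0≤+ 1) (solve (i ∷ j ∷ []))

i<i+1 : ∀ i → i < i + 1ℤ
i<i+1 i = <-by (0≤+ 0) (solve (i ∷ []))

<⇒≡suc⊎suc< : ∀ {a t} → a < t → t ≡ a + 1ℤ ⊎ a + 1ℤ < t
<⇒≡suc⊎suc< {a} {t} a<t with t ≟ a + 1ℤ
... | yes t≡a+1 = inj₁ t≡a+1
... | no t≢a+1 = inj₂ (≤∧≢⇒< (≤-by (<⇒0≤ a<t) (solve (a ∷ t ∷ []))) (t≢a+1 ∘ sym))

double : ∀ m → + 2 * m ≡ m + m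
double = solve-∀

x+[s-x]≡s : ∀ s x → x + (s - x) ≡ s
x+[s-x]≡s = solve-∀

-- Cardinality of lists

unique⊆⇒length≤ : ∀ {a} {A : Set a} {xs : List A} ys → Unique xs → xs ⊆ ys → length xs ℕ.≤ length ys
unique⊆⇒length≤ {xs = []} ys _ _ = z≤n
unique⊆⇒length≤ {A = A} {x ∷ xs} ys (x∉xs ∷ xs!) xs⊆ys with ∈-∃++ (xs⊆ys (here refl))
... | as , bs , refl =
  ℕ.≤-trans (s≤s (unique⊆⇒length≤ (as ++ bs) xs! xs⊆as++bs)) (ℕ.≤-reflexive (length-middle as))
  where
  xs⊆as++bs : xs ⊆ as ++ bs
  xs⊆as++bs y∈xs with ∈-++⁻ as (xs⊆ys (there y∈xs))
  ... | inj₁ y∈as = ∈-++⁺ˡ y∈as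
  ... | inj₂ (here refl) = ⊥-elim (All.lookup x∉xs y∈xs refl)
  ... | inj₂ (there y∈bs) = ∈-++⁺ʳ as y∈bs
  length-middle : ∀ (as : List A) {bs} → suc (length (as ++ bs)) ≡ length (as ++ x ∷ bs)
  length-middle [] = refl
  length-middle (_ ∷ as) = cong suc (length-middle as)

dedup : List ℤ → List ℤ
dedup = deduplicate _≟_

unique⊆⇒length≤card : ∀ {xs ys} → Unique xs → xs ⊆ ys → length xs ℕ.≤ card ys
unique⊆⇒length≤card xs! xs⊆ys = unique⊆⇒length≤ _ xs! (∈-deduplicate⁺ _≟_ ∘ xs⊆ys)

card-mono : ∀ {X Y} → X ⊆ Y → card X ℕ.≤ card Y
card-mono {X} X⊆Y = unique⊆⇒length≤card (deduplicate-! X) (X⊆Y ∘ ∈-deduplicate⁻ _≟_ X)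

card-cong : ∀ {X Y} → X ⊆ Y → Y ⊆ X → card X ≡ card Y
card-cong X⊆Y Y⊆X = ℕ.≤-antisym (card-mono X⊆Y) (card-mono Y⊆X)

card-unique : ∀ {X} → Unique X → card X ≡ length X
card-unique {X} X! = ℕ.≤-antisym
  (unique⊆⇒length≤ X (deduplicate-! X) (∈-deduplicate⁻ _≟_ X)) (unique⊆⇒length≤card X! id)

card-++ : ∀ {X Y} → Disjoint X Y → card (X ++ Y) ≡ card X ℕ.+ card Y
card-++ {X} {Y} X#Y = begin
  card (X ++ Y)               ≡⟨ card-cong to from ⟩
  card (dedup X ++ dedup Y)   ≡⟨ card-unique (Unique.++⁺ (deduplicate-! X) (deduplicate-! Y) dedup-#) ⟩
  length (dedup X ++ dedup Y) ≡⟨ length-++ (dedup X) ⟩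
  card X ℕ.+ card Y           ∎
  where
  open ≡-Reasoning
  to : X ++ Y ⊆ dedup X ++ dedup Y
  to = [ ∈-++⁺ˡ ∘ ∈-deduplicate⁺ _≟_ , ∈-++⁺ʳ (dedup X) ∘ ∈-deduplicate⁺ _≟_ ] ∘ ∈-++⁻ X
  from : dedup X ++ dedup Y ⊆ X ++ Y
  from = [ ∈-++⁺ˡ ∘ ∈-deduplicate⁻ _≟_ X , ∈-++⁺ʳ X ∘ ∈-deduplicate⁻ _≟_ Y ] ∘ ∈-++⁻ (dedup X)
  dedup-# : Disjoint (dedup X) (dedup Y)
  dedup-# (p , q) = X#Y (∈-deduplicate⁻ _≟_ X p , ∈-deduplicate⁻ _≟_ Y q)

card-++-separated : ∀ {X Y} c → (∀ {x} → x ∈ X → x < c) → (∀ {y} → y ∈ Y → c ≤ y) →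
                    card (X ++ Y) ≡ card X ℕ.+ card Y
card-++-separated c X<c c≤Y = card-++ λ (x∈X , x∈Y) → <-irrefl refl (<-≤-trans (X<c x∈X) (c≤Y x∈Y))

card-map : ∀ {f : ℤ → ℤ} → Injective _≡_ _≡_ f → ∀ X → card (map f X) ≡ card X
card-map {f} f-inj X = begin
  card (map f X)           ≡⟨ card-cong (map-⊆ (∈-deduplicate⁺ _≟_)) (map-⊆ (∈-deduplicate⁻ _≟_ X)) ⟩
  card (map f (dedup X))   ≡⟨ card-unique (Unique.map⁺ f-inj (deduplicate-! X)) ⟩
  length (map f (dedup X)) ≡⟨ length-map f (dedup X) ⟩
  card X                   ∎
  where
  open ≡-Reasoning
  map-⊆ : ∀ {Y Z} → Y ⊆ Z → map f Y ⊆ map f Z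
  map-⊆ Y⊆Z p with y , y∈Y , refl ← ∈-map⁻ f p = ∈-map⁺ f (Y⊆Z y∈Y)

⊆∧card≥⇒⊇ : ∀ {X Y} → X ⊆ Y → card Y ℕ.≤ card X → Y ⊆ X
⊆∧card≥⇒⊇ {X} {Y} X⊆Y card-Y≤card-X {y} y∈Y with y ∈? X
... | yes y∈X = y∈X
... | no y∉X = ⊥-elim (ℕ.<-irrefl refl (ℕ.<-≤-trans card-X<card-Y card-Y≤card-X))
  where
  card-X<card-Y : card X ℕ.< card Y
  card-X<card-Y = subst (ℕ._≤ card Y)
    (trans (card-++ {X} {y ∷ []} λ { (p , here refl) → y∉X p }) (ℕ.+-comm (card X) 1))
    (card-mono ([ X⊆Y , (λ { (here refl) → y∈Y }) ] ∘ ∈-++⁻ X))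

-- Sumsets, translates and reflections

∈-twice⁺ : ∀ {X x y} → x ∈ X → y ∈ X → x + y ∈ twice X
∈-twice⁺ = ∈-cartesianProductWith⁺ _+_

∈-twice⁻ : ∀ {X t} → t ∈ twice X → ∃₂ λ x y → x ∈ X × y ∈ X × t ≡ x + y
∈-twice⁻ {X} = ∈-cartesianProductWith⁻ _+_ X X

twice-mono : ∀ {X Y} → X ⊆ Y → twice X ⊆ twice Y
twice-mono X⊆Y t∈2X with x , y , x∈X , y∈X , refl ← ∈-twice⁻ t∈2X = ∈-twice⁺ (X⊆Y x∈X) (X⊆Y y∈X)

∈⇒shift⊆twice : ∀ {b X} → b ∈ X → shift b X ⊆ twice X
∈⇒shift⊆twice {b} b∈X t∈b+X with x , x∈X , refl ← ∈-map⁻ (_+_ b) t∈b+X = ∈-twice⁺ b∈X x∈X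

shift-injective : ∀ {t} → Injective _≡_ _≡_ (_+_ t)
shift-injective {t} {x} {y} t+x≡t+y = begin
  x         ≡⟨ solve (t ∷ x ∷ []) ⟩
  t + x - t ≡⟨ cong (_- t) t+x≡t+y ⟩
  t + y - t ≡⟨ solve (t ∷ y ∷ []) ⟩
  y         ∎
  where open ≡-Reasoning

card-shift : ∀ t X → card (shift t X) ≡ card X
card-shift t = card-map (shift-injective {t})

reflect : ℤ → List ℤ → List ℤ
reflect s = map (s -_)

reflect-involutive : ∀ s x → s - (s - x) ≡ x
reflect-involutive = solve-∀

∈-reflect⁺ : ∀ s {X x} → x ∈ X → s - x ∈ reflect s X
∈-reflect⁺ s = ∈-map⁺ (s -_)

∈-reflect⁻ : ∀ s {X y} → y ∈ reflect s X → s - y ∈ X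
∈-reflect⁻ s {X} y∈s-X with x , x∈X , refl ← ∈-map⁻ (s -_) y∈s-X =
  subst (_∈ X) (sym (reflect-involutive s x)) x∈X

card-reflect : ∀ s X → card (reflect s X) ≡ card X
card-reflect s = card-map λ {x} {y} s-x≡s-y → begin
  x           ≡⟨ reflect-involutive s x ⟨
  s - (s - x) ≡⟨ cong (s -_) s-x≡s-y ⟩
  s - (s - y) ≡⟨ reflect-involutive s y ⟩
  y           ∎
  where open ≡-Reasoning

∉twice⇔reflect-∉ : ∀ s X → (s ∉ twice X) ⇔ (∀ x → x ∈ X → s - x ∉ X)
∉twice⇔reflect-∉ s X = mk⇔
  (λ s∉2X x x∈X s-x∈X → s∉2X (subst (_∈ twice X) (x+[s-x]≡s s x) (∈-twice⁺ x∈X s-x∈X)))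
  (λ s-X∉X s∈2X → let x , y , x∈X , y∈X , s≡x+y = ∈-twice⁻ s∈2X in
     s-X∉X x x∈X (subst (_∈ X) (y≡s-x s≡x+y) y∈X))
  where
  y≡s-x : ∀ {x y} → s ≡ x + y → y ≡ s - x
  y≡s-x {x} {y} refl = solve (x ∷ y ∷ [])

∉twice⇒disjoint-reflect : ∀ {s X} → s ∉ twice X → Disjoint X (reflect s X)
∉twice⇒disjoint-reflect {s} {X} s∉2X {y} (y∈X , y∈s-X) =
  Equivalence.to (∉twice⇔reflect-∉ s X) s∉2X (s - y) (∈-reflect⁻ s y∈s-X)
    (subst (_∈ X) (sym (reflect-involutive s y)) y∈X)

card-++-reflect : ∀ {s X} → Disjoint X (reflect s X) → card (X ++ reflect s X) ≡ card X ℕ.+ card X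
card-++-reflect {s} {X} X#s-X = trans (card-++ X#s-X) (cong (card X ℕ.+_) (card-reflect s X))

-- Intervals and windows

+∣b-a+1∣≡b-a+1 : ∀ {a b} → a ≤ b + 1ℤ → + ∣ b - a + 1ℤ ∣ ≡ b - a + 1ℤ
+∣b-a+1∣≡b-a+1 {a} {b} a≤b+1 = 0≤i⇒+∣i∣≡i (0≤-by (≤⇒0≤ a≤b+1) (solve (a ∷ b ∷ [])))

-- The length ∣ b - a + 1 ∣ is junk when b + 1 < a, so the lemmas below assume a ≤ b + 1.
interval : ℤ → ℤ → List ℤ
interval a b = applyUpTo (λ i → a + + i) ∣ b - a + 1ℤ ∣

∈-interval⁺ : ∀ a b {x} → InIv a b x → x ∈ interval a b
∈-interval⁺ a b {x} (a≤x , x≤b) =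
  subst (_∈ interval a b) a+[x-a]≡x (∈-applyUpTo⁺ (λ i → a + + i) ∣x-a∣<∣b-a+1∣)
  where
  open ≡-Reasoning
  +∣x-a∣≡x-a : + ∣ x - a ∣ ≡ x - a
  +∣x-a∣≡x-a = 0≤i⇒+∣i∣≡i (≤⇒0≤ a≤x)
  +∣b-a+1∣≡ : + ∣ b - a + 1ℤ ∣ ≡ b - a + 1ℤ
  +∣b-a+1∣≡ = +∣b-a+1∣≡b-a+1 {a} {b} (≤⇒≤+1 (≤-trans a≤x x≤b))
  ∣x-a∣<∣b-a+1∣ : ∣ x - a ∣ ℕ.< ∣ b - a + 1ℤ ∣
  ∣x-a∣<∣b-a+1∣ = drop‿+<+ (<-by (≤⇒0≤ x≤b) (begin
    b - x                               ≡⟨ solve (a ∷ b ∷ x ∷ []) ⟩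
    (b - a + 1ℤ) - (x - a) - 1ℤ         ≡⟨ cong₂ (λ m k → m - k - 1ℤ) +∣b-a+1∣≡ +∣x-a∣≡x-a ⟨
    + ∣ b - a + 1ℤ ∣ - + ∣ x - a ∣ - 1ℤ ∎))
  a+[x-a]≡x : a + + ∣ x - a ∣ ≡ x
  a+[x-a]≡x = trans (cong (_+_ a) +∣x-a∣≡x-a) (solve (a ∷ x ∷ []))

∈-interval⁻ : ∀ a b {x} → a ≤ b + 1ℤ → x ∈ interval a b → InIv a b x
∈-interval⁻ a b a≤b+1 x∈[a,b] with i , i<n , refl ← ∈-applyUpTo⁻ (λ i → a + + i) x∈[a,b] =
  ≤-by (0≤+ i) (lower a (+ i)) ,
  ≤-by (<⇒0≤ (+<+ i<n))
    (trans (cong (λ n → n - + i - 1ℤ) (+∣b-a+1∣≡b-a+1 {a} {b} a≤b+1)) (upper a b (+ i)))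
  where
  lower : ∀ a k → k ≡ a + k - a
  lower = solve-∀
  upper : ∀ a b k → b - a + 1ℤ - k - 1ℤ ≡ b - (a + k)
  upper = solve-∀

card-interval : ∀ a b → a ≤ b + 1ℤ → + card (interval a b) ≡ b - a + 1ℤ
card-interval a b a≤b+1 = begin
  + card (interval a b)   ≡⟨ cong +_ (card-unique (Unique.applyUpTo⁺₁ f n f-injective)) ⟩
  + length (interval a b) ≡⟨ cong +_ (length-applyUpTo f n) ⟩
  + n                     ≡⟨ +∣b-a+1∣≡b-a+1 {a} {b} a≤b+1 ⟩
  b - a + 1ℤ              ∎
  where
  open ≡-Reasoning
  f : ℕ → ℤ
  f i = a + + i
  n : ℕ
  n = ∣ b - a + 1ℤ ∣
  f-injective : ∀ {i j} → i ℕ.< j → j ℕ.< n → f i ≢ f j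
  f-injective i<j _ = ℕ.<⇒≢ i<j ∘ +-injective ∘ shift-injective {a}

reflect-InIv : ∀ {a b x} → InIv a b x → InIv a b (a + b - x)
reflect-InIv {a} {b} {x} (a≤x , x≤b) =
  ≤-by (≤⇒0≤ x≤b) (solve (a ∷ b ∷ x ∷ [])) , ≤-by (≤⇒0≤ a≤x) (solve (a ∷ b ∷ x ∷ []))

++reflect⊆interval : ∀ {a b X} → SubIv a b X → X ++ reflect (a + b) X ⊆ interval a b
++reflect⊆interval {a} {b} {X} X⊆[a,b] y∈X++a+b-X with ∈-++⁻ X y∈X++a+b-X
... | inj₁ y∈X = ∈-interval⁺ a b (X⊆[a,b] _ y∈X)
... | inj₂ y∈a+b-X with x , x∈X , refl ← ∈-map⁻ ((a + b) -_) y∈a+b-X =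
  ∈-interval⁺ a b (reflect-InIv (X⊆[a,b] x x∈X))

-- cnt X a b unfolds to card (window a b X).
window : ℤ → ℤ → List ℤ → List ℤ
window a b = filter (λ x → (a ≤? x) ×-dec (x ≤? b))

∈-window⁻ : ∀ a b X {x} → x ∈ window a b X → x ∈ X × InIv a b x
∈-window⁻ a b X = ∈-filter⁻ (λ x → (a ≤? x) ×-dec (x ≤? b))

∈-window⁺ : ∀ a b {X x} → x ∈ X → InIv a b x → x ∈ window a b X
∈-window⁺ a b = ∈-filter⁺ (λ x → (a ≤? x) ×-dec (x ≤? b))

cnt≡card : ∀ {a b X} → SubIv a b X → cnt X a b ≡ card X
cnt≡card {a} {b} {X} X⊆[a,b] =
  card-cong (proj₁ ∘ ∈-window⁻ a b X) (λ {x} x∈X → ∈-window⁺ a b x∈X (X⊆[a,b] x x∈X))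

cnt-suc≤ : ∀ {a b c y X} → y ∈ X → InIv a b y → c < y → c ≤ b → suc (cnt X a c) ℕ.≤ cnt X a b
cnt-suc≤ {a} {b} {c} {y} {X} y∈X y∈[a,b] c<y c≤b = begin
  suc (cnt X a c)               ≡⟨ ℕ.+-comm 1 (cnt X a c) ⟩
  cnt X a c ℕ.+ 1               ≡⟨ card-++-separated y below (λ { (here refl) → ≤-refl }) ⟨
  card (window a c X ++ y ∷ []) ≤⟨ card-mono inside ⟩
  cnt X a b                     ∎
  where
  open ℕ.≤-Reasoning
  below : ∀ {x} → x ∈ window a c X → x < y
  below x∈W = ≤-<-trans (proj₂ (proj₂ (∈-window⁻ a c X x∈W))) c<y
  inside : window a c X ++ y ∷ [] ⊆ window a b X
  inside x∈W++y with ∈-++⁻ (window a c X) x∈W++y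
  ... | inj₁ x∈W = let x∈X , a≤x , x≤c = ∈-window⁻ a c X x∈W in ∈-window⁺ a b x∈X (a≤x , ≤-trans x≤c c≤b)
  ... | inj₂ (here refl) = ∈-window⁺ a b y∈X y∈[a,b]

cnt-∉ : ∀ {a b y X} → y ∉ X → InIv a b y → + cnt X a b ≤ b - a
cnt-∉ {a} {b} {y} {X} y∉X (a≤y , y≤b) = ≤-by (≤⇒0≤ bound) (drop-one a b (+ cnt X a b))
  where
  disjoint : Disjoint (window a b X) (y ∷ [])
  disjoint (y∈W , here refl) = y∉X (proj₁ (∈-window⁻ a b X y∈W))
  inside : window a b X ++ y ∷ [] ⊆ interval a b
  inside x∈W++y with ∈-++⁻ (window a b X) x∈W++y
  ... | inj₁ x∈W = ∈-interval⁺ a b (proj₂ (∈-window⁻ a b X x∈W))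
  ... | inj₂ (here refl) = ∈-interval⁺ a b (a≤y , y≤b)
  bound : + cnt X a b + 1ℤ ≤ b - a + 1ℤ
  bound = subst₂ _≤_ (cong +_ (card-++ disjoint)) (card-interval a b (≤⇒≤+1 (≤-trans a≤y y≤b)))
                 (+≤+ (card-mono inside))
  drop-one : ∀ a b c → b - a + 1ℤ - (c + 1ℤ) ≡ b - a - c
  drop-one = solve-∀

∉twice⇒cnt≤ : ∀ {a b X} → a ≤ b + 1ℤ → a + b ∉ twice X → + cnt X a b + + cnt X a b ≤ b - a + 1ℤ
∉twice⇒cnt≤ {a} {b} {X} a≤b+1 a+b∉2X =
  subst₂ _≤_ (cong +_ (card-++-reflect {a + b} {W} W#a+b-W)) (card-interval a b a≤b+1)
    (+≤+ (card-mono (++reflect⊆interval (λ x x∈W → proj₂ (∈-window⁻ a b X x∈W)))))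
  where
  W = window a b X
  W#a+b-W : Disjoint W (reflect (a + b) W)
  W#a+b-W = ∉twice⇒disjoint-reflect {a + b} {W} (a+b∉2X ∘ twice-mono (proj₁ ∘ ∈-window⁻ a b X))

halfDense⇔card : ∀ {u v B} → SubIv u v B → HalfDense u v B ⇔ (+ card B + + card B ≡ v - u + 1ℤ)
halfDense⇔card {u} {v} {B} B⊆[u,v] = mk⇔
  (λ half → trans (sym (double (+ card B))) (subst P (cnt≡card B⊆[u,v]) half))
  (λ 2|B| → subst P (sym (cnt≡card B⊆[u,v])) (trans (double (+ card B)) 2|B|))
  where
  P : ℕ → Set
  P c = + 2 * + c ≡ v - u + 1ℤ

-- Anti-symmetric and left dense sets

antiSym⇔halfDense∧∉twice : ∀ u v B → u ≤ v → SubIv u v B →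
                           AntiSym u v B ⇔ (HalfDense u v B × (u + v) ∉ twice B)
antiSym⇔halfDense∧∉twice u v B u≤v B⊆[u,v] = mk⇔
  (λ (reflect-∉ , covers) → let s∉2B = Equivalence.from (∉twice⇔reflect-∉ s B) reflect-∉ in
     Equivalence.from (halfDense⇔card B⊆[u,v])
       (trans (sym (card-B* s∉2B)) (trans (cong +_ (card-cong B*⊆I (I⊆B* covers))) card-I)) ,
     s∉2B)
  (λ (half , s∉2B) → Equivalence.to (∉twice⇔reflect-∉ s B) s∉2B ,
     λ x x∈[u,v] → from-B* (⊆∧card≥⇒⊇ B*⊆I (ℕ.≤-reflexive (+-injective (begin
       + card (interval u v) ≡⟨ card-I ⟩
       v - u + 1ℤ            ≡⟨ Equivalence.to (halfDense⇔card B⊆[u,v]) half ⟨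
       + card B + + card B   ≡⟨ card-B* s∉2B ⟨
       + card B*             ∎))) (∈-interval⁺ u v x∈[u,v])))
  where
  open ≡-Reasoning
  s = u + v
  B* = B ++ reflect s B
  B*⊆I : B* ⊆ interval u v
  B*⊆I = ++reflect⊆interval B⊆[u,v]
  card-I : + card (interval u v) ≡ v - u + 1ℤ
  card-I = card-interval u v (≤⇒≤+1 u≤v)
  card-B* : s ∉ twice B → + card B* ≡ + card B + + card B
  card-B* s∉2B = cong +_ (card-++-reflect {s} {B} (∉twice⇒disjoint-reflect {s} {B} s∉2B))
  I⊆B* : (∀ x → InIv u v x → x ∈ B ⊎ s - x ∈ B) → interval u v ⊆ B*
  I⊆B* covers x∈I with covers _ (∈-interval⁻ u v (≤⇒≤+1 u≤v) x∈I)
  ... | inj₁ x∈B = ∈-++⁺ˡ x∈B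
  ... | inj₂ s-x∈B = ∈-++⁺ʳ B (subst (_∈ reflect s B) (reflect-involutive s _) (∈-reflect⁺ s s-x∈B))
  from-B* : ∀ {x} → x ∈ B* → x ∈ B ⊎ s - x ∈ B
  from-B* = map₂ (∈-reflect⁻ s) ∘ ∈-++⁻ B

-- If t ∉ 2B, the window [u, t - u] holds at most half of its points, against left density.
leftDense⇒interval⊆twice : ∀ {u v B} → LeftDense u v B →
                           ∀ {t} → InIv (+ 2 * u) (u + v - 1ℤ) t → t ∈ twice B
leftDense⇒interval⊆twice {u} {v} {B} (_ , dense) {t} (2u≤t , t≤u+v-1) =
  decidable-stable (t ∈? twice B) λ t∉2B →
  <-irrefl refl (<-≤-trans
    (subst (t - u - u + 1ℤ <_) (double (+ cnt B u (t - u))) (dense (t - u) (u≤t-u , t-u≤v-1)))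
    (∉twice⇒cnt≤ {X = B} (≤⇒≤+1 u≤t-u) (t∉2B ∘ subst (_∈ twice B) (x+[s-x]≡s t u))))
  where
  u≤t-u : u ≤ t - u
  u≤t-u = ≤-by (≤⇒0≤ 2u≤t) (solve (u ∷ t ∷ []))
  t-u≤v-1 : t - u ≤ v - 1ℤ
  t-u≤v-1 = ≤-by (≤⇒0≤ t≤u+v-1) (solve (u ∷ v ∷ t ∷ []))

leftDense⇒sumset⊇ : ∀ {u v B} → LeftDense u v B → ∀ t →
  InIv (+ 2 * u) (u + v - 1ℤ) t ⊎ t ∈ shift (v + 1ℤ) (B ++ v + 1ℤ ∷ []) → t ∈ twice (B ++ v + 1ℤ ∷ [])
leftDense⇒sumset⊇ {u} {v} {B} B-dense t =
  [ twice-mono {B} ∈-++⁺ˡ ∘ leftDense⇒interval⊆twice {u} {v} {B} B-dense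
  , ∈⇒shift⊆twice (∈-++⁺ʳ B (here refl))
  ]

leftDense⇒bottom∈ : ∀ {u v B x} → LeftDense u v B → InIv u (v - 1ℤ) x → x ≤ u + 1ℤ → x ∈ B
leftDense⇒bottom∈ {u} {v} {B} {x} (_ , dense) x∈[u,v-1] x≤u+1 = decidable-stable (x ∈? B) λ x∉B →
  impossible (+ cnt B u x) (dense x x∈[u,v-1]) (cnt-∉ x∉B (proj₁ x∈[u,v-1] , ≤-refl))
  where
  impossible : ∀ c → x - u + 1ℤ < + 2 * c → c ≤ x - u → ⊥
  impossible c dense sparse =
    impossible-by (<⇒0≤ dense ⊕ ≤⇒0≤ sparse ⊕ ≤⇒0≤ sparse ⊕ ≤⇒0≤ x≤u+1) (solve (u ∷ x ∷ c ∷ []))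

leftDense⇒∈⇒≤v-2 : ∀ {u v B y} → LeftDense u v B → y ∈ B → InIv (u + 1ℤ) v y → y ≤ v - + 2
leftDense⇒∈⇒≤v-2 {u} {v} {B} {y} (half , dense) y∈B (u+1≤y , y≤v) =
  bound (+ cnt B u (y - 1ℤ)) (+ cnt B u v)
    (dense (y - 1ℤ) (u≤y-1 , y-1≤v-1)) (+≤+ (cnt-suc≤ y∈B (u≤y , y≤v) y-1<y y-1≤v)) half
  where
  u≤y-1 : u ≤ y - 1ℤ
  u≤y-1 = ≤-by (≤⇒0≤ u+1≤y) (solve (u ∷ y ∷ []))
  y-1≤v-1 : y - 1ℤ ≤ v - 1ℤ
  y-1≤v-1 = ≤-by (≤⇒0≤ y≤v) (solve (v ∷ y ∷ []))
  u≤y : u ≤ y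
  u≤y = ≤-by (≤⇒0≤ u+1≤y ⊕ 0≤+ 1) (solve (u ∷ y ∷ []))
  y-1<y : y - 1ℤ < y
  y-1<y = <-by (0≤+ 0) (solve (y ∷ []))
  y-1≤v : y - 1ℤ ≤ v
  y-1≤v = ≤-by (≤⇒0≤ y≤v ⊕ 0≤+ 1) (solve (v ∷ y ∷ []))
  bound : ∀ c₁ c₂ → y - 1ℤ - u + 1ℤ < + 2 * c₁ → 1ℤ + c₁ ≤ c₂ → + 2 * c₂ ≡ v - u + 1ℤ → y ≤ v - + 2
  bound c₁ c₂ dense step half =
    ≤-by (<⇒0≤ dense ⊕ ≤⇒0≤ step ⊕ ≤⇒0≤ step ⊕ ≤⇒0≤ (≤-reflexive half)) (solve (u ∷ v ∷ y ∷ c₁ ∷ c₂ ∷ []))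

leftDense⇒ends : ∀ u v B → LeftDense u v B → v - u > 1ℤ → u ∈ B × u + 1ℤ ∈ B × v ∉ B × v - 1ℤ ∉ B
leftDense⇒ends u v B B-dense 1<v-u =
  leftDense⇒bottom∈ B-dense (≤-refl , u≤v-1) u≤u+1 ,
  leftDense⇒bottom∈ B-dense (u≤u+1 , u+1≤v-1) ≤-refl ,
  (λ v∈B → too-high (≤-trans v-1≤v (leftDense⇒∈⇒≤v-2 B-dense v∈B (≤-trans u+1≤v-1 v-1≤v , ≤-refl)))) ,
  (λ v-1∈B → too-high (leftDense⇒∈⇒≤v-2 B-dense v-1∈B (u+1≤v-1 , v-1≤v)))
  where
  gap : 0ℤ ≤ v - u - 1ℤ - 1ℤ
  gap = <⇒0≤ 1<v-u
  u≤u+1 : u ≤ u + 1ℤ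
  u≤u+1 = ≤⇒≤+1 ≤-refl
  u≤v-1 : u ≤ v - 1ℤ
  u≤v-1 = ≤-by (gap ⊕ 0≤+ 1) (solve (u ∷ v ∷ []))
  u+1≤v-1 : u + 1ℤ ≤ v - 1ℤ
  u+1≤v-1 = ≤-by gap (solve (u ∷ v ∷ []))
  v-1≤v : v - 1ℤ ≤ v
  v-1≤v = ≤-by (0≤+ 1) (solve (v ∷ []))
  too-high : v - 1ℤ ≤ v - + 2 → ⊥
  too-high v-1≤v-2 = impossible-by (≤⇒0≤ v-1≤v-2) (solve (v ∷ []))

rightDense⇒top∈ : ∀ {u v B x} → RightDense u v B → InIv (u + 1ℤ) v x → v - 1ℤ ≤ x → x ∈ B
rightDense⇒top∈ {u} {v} {B} {x} (_ , dense) x∈[u+1,v] v-1≤x = decidable-stable (x ∈? B) λ x∉B →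
  impossible (+ cnt B x v) (dense x x∈[u+1,v]) (cnt-∉ x∉B (≤-refl , proj₂ x∈[u+1,v]))
  where
  impossible : ∀ c → v - x + 1ℤ < + 2 * c → c ≤ v - x → ⊥
  impossible c dense sparse =
    impossible-by (<⇒0≤ dense ⊕ ≤⇒0≤ sparse ⊕ ≤⇒0≤ sparse ⊕ ≤⇒0≤ v-1≤x) (solve (v ∷ x ∷ c ∷ []))

step-down⇒down-closed : ∀ {a X} → (∀ {x} → x ∈ X → a < x → x - 1ℤ ∈ X) →
                        ∀ {x y} → x ∈ X → a ≤ y → y ≤ x → y ∈ X
step-down⇒down-closed {a} {X} step {x} {y} x∈X a≤y y≤x =
  go ∣ x - y ∣ x∈X (trans (cong (_+_ y) (0≤i⇒+∣i∣≡i (≤⇒0≤ y≤x))) (x+[s-x]≡s x y))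
  where
  a<y+[1+k] : ∀ k → 0ℤ ≤ k → a < y + (1ℤ + k)
  a<y+[1+k] k 0≤k = <-by (≤⇒0≤ a≤y ⊕ 0≤k) (solve (a ∷ y ∷ k ∷ []))
  y+[1+k]-1≡y+k : ∀ k → y + (1ℤ + k) - 1ℤ ≡ y + k
  y+[1+k]-1≡y+k k = solve (y ∷ k ∷ [])
  go : ∀ k {x} → x ∈ X → y + + k ≡ x → y ∈ X
  go zero x∈X y+0≡x = subst (_∈ X) (trans (sym y+0≡x) (+-identityʳ y)) x∈X
  go (suc k) x∈X refl = go k (step x∈X (a<y+[1+k] (+ k) (0≤+ k))) (sym (y+[1+k]-1≡y+k (+ k)))

-- Sumsets of left dense sets

module LeftDenseSumset {u v B} (u≤v : u ≤ v) (B⊆[u,v] : SubIv u v B) (B-dense : LeftDense u v B) where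

  B⁺ : ℤ → List ℤ
  B⁺ b = B ++ b ∷ []

  Lower : List ℤ
  Lower = interval (+ 2 * u) (u + v - 1ℤ)

  2u≤u+v : + 2 * u ≤ u + v - 1ℤ + 1ℤ
  2u≤u+v = ≤-by (≤⇒0≤ u≤v) (solve (u ∷ v ∷ []))

  card-Lower : + card Lower ≡ v - u
  card-Lower = trans (card-interval (+ 2 * u) (u + v - 1ℤ) 2u≤u+v) length≡
    where
    length≡ : u + v - 1ℤ - + 2 * u + 1ℤ ≡ v - u
    length≡ = solve (u ∷ v ∷ [])

  Lower<u+v : ∀ {x} → x ∈ Lower → x < u + v
  Lower<u+v {x} x∈L =
    <-by (≤⇒0≤ (proj₂ (∈-interval⁻ (+ 2 * u) (u + v - 1ℤ) 2u≤u+v x∈L))) (solve (u ∷ v ∷ x ∷ []))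

  Lower⊆twice : ∀ b → Lower ⊆ twice (B⁺ b)
  Lower⊆twice b = twice-mono {B} ∈-++⁺ˡ ∘ leftDense⇒interval⊆twice {u} {v} {B} B-dense
                ∘ ∈-interval⁻ (+ 2 * u) (u + v - 1ℤ) 2u≤u+v

  b+u≤shift : ∀ {b y} → v < b → y ∈ shift b (B⁺ b) → b + u ≤ y
  b+u≤shift {b} v<b y∈b+B⁺ with a , a∈B⁺ , refl ← ∈-map⁻ (_+_ b) y∈b+B⁺ =
    ≤-by (≤⇒0≤ (u≤ a∈B⁺)) (solve (b ∷ u ∷ a ∷ []))
    where
    u≤ : ∀ {a} → a ∈ B⁺ b → u ≤ a
    u≤ a∈B⁺ with ∈-++⁻ B a∈B⁺
    ... | inj₁ a∈B = proj₁ (B⊆[u,v] _ a∈B)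
    ... | inj₂ (here refl) = ≤-trans u≤v (<⇒≤ v<b)

  card-B⁺ : ∀ {b} → v < b → card (B⁺ b) ≡ card B ℕ.+ 1
  card-B⁺ {b} v<b =
    card-++-separated b (λ {x} x∈B → ≤-<-trans (proj₂ (B⊆[u,v] x x∈B)) v<b) λ { (here refl) → ≤-refl }

  3|B⁺|-3≡v-u+|B⁺| : ∀ {b} → v < b → + 3 * + card (B⁺ b) - + 3 ≡ v - u + + card (B⁺ b)
  3|B⁺|-3≡v-u+|B⁺| {b} v<b = arithmetic (+ card (B⁺ b)) (+ card B) (cong +_ (card-B⁺ v<b))
                                         (Equivalence.to (halfDense⇔card B⊆[u,v]) (proj₁ B-dense))
    where
    arithmetic : ∀ a c → a ≡ c + 1ℤ → c + c ≡ v - u + 1ℤ → + 3 * a - + 3 ≡ v - u + a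
    arithmetic .(c + 1ℤ) c refl 2c≡v-u+1 = begin
      + 3 * (c + 1ℤ) - + 3       ≡⟨ solve (c ∷ []) ⟩
      c + c + (c + 1ℤ) - 1ℤ      ≡⟨ cong (λ z → z + (c + 1ℤ) - 1ℤ) 2c≡v-u+1 ⟩
      v - u + 1ℤ + (c + 1ℤ) - 1ℤ ≡⟨ solve (u ∷ v ∷ c ∷ []) ⟩
      v - u + (c + 1ℤ)           ∎
      where open ≡-Reasoning

  card-Lower++E++shift : ∀ {b} (E : List ℤ) → v < b → (∀ {e} → e ∈ E → InIv (u + v) (b + u - 1ℤ) e) →
                         + card (Lower ++ E ++ shift b (B⁺ b)) ≡ v - u + (+ card E + + card (B⁺ b))
  card-Lower++E++shift {b} E v<b E∈[u+v,b+u-1] = begin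
    + card (Lower ++ E ++ shift b (B⁺ b))
      ≡⟨ cong +_ (card-++-separated (u + v) Lower<u+v u+v≤E++S) ⟩
    + card Lower + + card (E ++ shift b (B⁺ b))
      ≡⟨ cong₂ _+_ card-Lower (cong +_ (card-++-separated (b + u) E<b+u (b+u≤shift v<b))) ⟩
    v - u + (+ card E + + card (shift b (B⁺ b)))
      ≡⟨ cong (λ k → v - u + (+ card E + + k)) (card-shift b (B⁺ b)) ⟩
    v - u + (+ card E + + card (B⁺ b))
      ∎
    where
    open ≡-Reasoning
    E<b+u : ∀ {e} → e ∈ E → e < b + u
    E<b+u {e} e∈E = <-by (≤⇒0≤ (proj₂ (E∈[u+v,b+u-1] e∈E))) (solve (b ∷ u ∷ e ∷ []))
    u+v≤b+u : u + v ≤ b + u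
    u+v≤b+u = ≤-by (<⇒0≤ v<b ⊕ 0≤+ 1) (solve (u ∷ v ∷ b ∷ []))
    u+v≤E++S : ∀ {y} → y ∈ E ++ shift b (B⁺ b) → u + v ≤ y
    u+v≤E++S y∈E++S with ∈-++⁻ E y∈E++S
    ... | inj₁ y∈E = proj₁ (E∈[u+v,b+u-1] y∈E)
    ... | inj₂ y∈S = ≤-trans u+v≤b+u (b+u≤shift v<b y∈S)

  Lower++shift⊆twice : Lower ++ shift (v + 1ℤ) (B⁺ (v + 1ℤ)) ⊆ twice (B⁺ (v + 1ℤ))
  Lower++shift⊆twice = [ Lower⊆twice (v + 1ℤ) , ∈⇒shift⊆twice (∈-++⁺ʳ B (here refl)) ] ∘ ∈-++⁻ Lower

  card-Lower++shift : + card (Lower ++ shift (v + 1ℤ) (B⁺ (v + 1ℤ))) ≡ + 3 * + card (B⁺ (v + 1ℤ)) - + 3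
  card-Lower++shift = trans (card-Lower++E++shift [] (i<i+1 v) λ ()) (sym (3|B⁺|-3≡v-u+|B⁺| (i<i+1 v)))

  card-twice≡⇔antiSym∧addMin : (+ card (twice (B⁺ (v + 1ℤ))) ≡ + 3 * + card (B⁺ (v + 1ℤ)) - + 3) ⇔
                               (AntiSym u v B × AddMinL u v B)
  card-twice≡⇔antiSym∧addMin = mk⇔
    (λ card≡ → let 2A⊆ = ⊆∧card≥⇒⊇ Lower++shift⊆twice
                                     (ℕ.≤-reflexive (+-injective (trans card≡ (sym card-Lower++shift)))) in
       Equivalence.from (antiSym⇔halfDense∧∉twice u v B u≤v B⊆[u,v]) (proj₁ B-dense , u+v∉2B 2A⊆) ,
       λ t → mk⇔ (from-Lower++shift ∘ 2A⊆) (leftDense⇒sumset⊇ {u} {v} {B} B-dense t))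
    (λ (_ , addMin) →
       trans (cong +_ (card-cong (to-Lower++shift ∘ Equivalence.to (addMin _)) Lower++shift⊆twice))
             card-Lower++shift)
    where
    A = B⁺ (v + 1ℤ)
    from-Lower++shift : ∀ {t} → t ∈ Lower ++ shift (v + 1ℤ) A →
                        InIv (+ 2 * u) (u + v - 1ℤ) t ⊎ t ∈ shift (v + 1ℤ) A
    from-Lower++shift = map₁ (∈-interval⁻ (+ 2 * u) (u + v - 1ℤ) 2u≤u+v) ∘ ∈-++⁻ Lower
    to-Lower++shift : ∀ {t} → InIv (+ 2 * u) (u + v - 1ℤ) t ⊎ t ∈ shift (v + 1ℤ) A →
                      t ∈ Lower ++ shift (v + 1ℤ) A
    to-Lower++shift = [ ∈-++⁺ˡ ∘ ∈-interval⁺ (+ 2 * u) (u + v - 1ℤ) , ∈-++⁺ʳ Lower ]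
    u+v<v+1+u : u + v < v + 1ℤ + u
    u+v<v+1+u = <-by (0≤+ 0) (solve (u ∷ v ∷ []))
    u+v∉2B : twice A ⊆ Lower ++ shift (v + 1ℤ) A → u + v ∉ twice B
    u+v∉2B 2A⊆ u+v∈2B with ∈-++⁻ Lower (2A⊆ (twice-mono {B} ∈-++⁺ˡ u+v∈2B))
    ... | inj₁ u+v∈L = <-irrefl refl (Lower<u+v u+v∈L)
    ... | inj₂ u+v∈S = <-irrefl refl (<-≤-trans u+v<v+1+u (b+u≤shift (i<i+1 v) u+v∈S))

  extra-sum⇒card> : ∀ {b e} → v + 1ℤ < b → e ∈ twice B → InIv (u + v) (u + v + 1ℤ) e →
                    + card (twice (B⁺ b)) > + 3 * + card (B⁺ b) - + 3
  extra-sum⇒card> {b} {e} v+1<b e∈2B (u+v≤e , e≤u+v+1) = begin-strict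
    + 3 * + card (B⁺ b) - + 3
      ≡⟨ 3|B⁺|-3≡v-u+|B⁺| v<b ⟩
    v - u + + card (B⁺ b)
      <⟨ i+j<i+[1+j] (v - u) (+ card (B⁺ b)) ⟩
    v - u + (1ℤ + + card (B⁺ b))
      ≡⟨ card-Lower++E++shift (e ∷ []) v<b (λ { (here refl) → u+v≤e , e≤b+u-1 }) ⟨
    + card (Lower ++ e ∷ shift b (B⁺ b))
      ≤⟨ +≤+ (card-mono sumset⊆) ⟩
    + card (twice (B⁺ b))
      ∎
    where
    open ≤-Reasoning
    i+j<i+[1+j] : ∀ i j → i + j < i + (1ℤ + j)
    i+j<i+[1+j] i j = <-by (0≤+ 0) (solve (i ∷ j ∷ []))
    v<b : v < b
    v<b = <-≤-trans (i<i+1 v) (<⇒≤ v+1<b)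
    e≤b+u-1 : e ≤ b + u - 1ℤ
    e≤b+u-1 = ≤-trans e≤u+v+1 (≤-by (<⇒0≤ v+1<b) (solve (u ∷ v ∷ b ∷ [])))
    e∈2B⁺ : e ∷ [] ⊆ twice (B⁺ b)
    e∈2B⁺ (here refl) = twice-mono {B} ∈-++⁺ˡ e∈2B
    sumset⊆ : Lower ++ e ∷ shift b (B⁺ b) ⊆ twice (B⁺ b)
    sumset⊆ = [ Lower⊆twice b , [ e∈2B⁺ , ∈⇒shift⊆twice (∈-++⁺ʳ B (here refl)) ] ∘ ∈-++⁻ (e ∷ []) ]
            ∘ ∈-++⁻ Lower

  sumFree⇒initialSegment : u + v ∉ twice B → u + v + 1ℤ ∉ twice B →
                           ∀ x → x ∈ B ⇔ (u ≤ x × + 2 * x ≤ u + v - 1ℤ)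
  sumFree⇒initialSegment u+v∉2B u+v+1∉2B x = mk⇔ lower-half lower-half⊆B
    where
    antiSym : AntiSym u v B
    antiSym = Equivalence.from (antiSym⇔halfDense∧∉twice u v B u≤v B⊆[u,v]) (proj₁ B-dense , u+v∉2B)
    covers : ∀ x → InIv u v x → x ∈ B ⊎ u + v - x ∈ B
    covers = proj₂ antiSym
    step : ∀ {y} → y ∈ B → u < y → y - 1ℤ ∈ B
    step {y} y∈B u<y =
      [ id , ⊥-elim ∘ u+v+1∉2B ∘ subst (_∈ twice B) y+[u+v-[y-1]]≡u+v+1 ∘ ∈-twice⁺ y∈B ]
      (covers (y - 1ℤ) (u≤y-1 , y-1≤v))
      where
      y+[u+v-[y-1]]≡u+v+1 : y + (u + v - (y - 1ℤ)) ≡ u + v + 1ℤ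
      y+[u+v-[y-1]]≡u+v+1 = solve (u ∷ v ∷ y ∷ [])
      u≤y-1 : u ≤ y - 1ℤ
      u≤y-1 = ≤-by (<⇒0≤ u<y) (solve (u ∷ y ∷ []))
      y-1≤v : y - 1ℤ ≤ v
      y-1≤v = ≤-by (≤⇒0≤ (proj₂ (B⊆[u,v] y y∈B)) ⊕ 0≤+ 1) (solve (v ∷ y ∷ []))
    down-closed : ∀ {y z} → y ∈ B → u ≤ z → z ≤ y → z ∈ B
    down-closed = step-down⇒down-closed step
    lower-half : x ∈ B → u ≤ x × + 2 * x ≤ u + v - 1ℤ
    lower-half x∈B = u≤x , decidable-stable (+ 2 * x ≤? u + v - 1ℤ) λ 2x≰u+v-1 →
      proj₁ antiSym x x∈B (down-closed x∈B u≤u+v-x (≤-by (<⇒0≤ (≰⇒> 2x≰u+v-1)) (solve (u ∷ v ∷ x ∷ []))))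
      where
      u≤x : u ≤ x
      u≤x = proj₁ (B⊆[u,v] x x∈B)
      u≤u+v-x : u ≤ u + v - x
      u≤u+v-x = ≤-by (≤⇒0≤ (proj₂ (B⊆[u,v] x x∈B))) (solve (u ∷ v ∷ x ∷ []))
    lower-half⊆B : u ≤ x × + 2 * x ≤ u + v - 1ℤ → x ∈ B
    lower-half⊆B (u≤x , 2x≤u+v-1) =
      [ id , (λ u+v-x∈B → down-closed u+v-x∈B u≤x x≤u+v-x) ] (covers x (u≤x , x≤v))
      where
      x≤u+v-x : x ≤ u + v - x
      x≤u+v-x = ≤-by (≤⇒0≤ 2x≤u+v-1 ⊕ 0≤+ 1) (solve (u ∷ v ∷ x ∷ []))
      x≤v : x ≤ v
      x≤v = ≤-by (≤⇒0≤ 2x≤u+v-1 ⊕ ≤⇒0≤ u≤x ⊕ 0≤+ 1) (solve (u ∷ v ∷ x ∷ []))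

  initialSegment⊎card> : (∀ x → x ∈ B ⇔ (u ≤ x × + 2 * x ≤ u + v - 1ℤ)) ⊎
                         (∀ b → b > v + 1ℤ → + card (twice (B⁺ b)) > + 3 * + card (B⁺ b) - + 3)
  initialSegment⊎card> with (u + v) ∈? twice B | (u + v + 1ℤ) ∈? twice B
  ... | yes u+v∈2B | _ = inj₂ λ b v+1<b → extra-sum⇒card> v+1<b u+v∈2B (≤-refl , ≤⇒≤+1 ≤-refl)
  ... | no _ | yes u+v+1∈2B = inj₂ λ b v+1<b → extra-sum⇒card> v+1<b u+v+1∈2B (≤⇒≤+1 ≤-refl , ≤-refl)
  ... | no u+v∉2B | no u+v+1∉2B = inj₁ (sumFree⇒initialSegment u+v∉2B u+v+1∉2B)

-- Gluing a right dense and a left dense set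

module Concatenation {n u C D} (4≤u : + 4 ≤ u) (u≤n-6 : u ≤ n - + 6)
  (C⊆[1,u] : SubIv 1ℤ u C) (C-dense : RightDense 1ℤ u C) (C-addMin : AddMinR 1ℤ u C)
  (D⊆[u+2,n-1] : SubIv (u + + 2) (n - 1ℤ) D) (D-dense : LeftDense (u + + 2) (n - 1ℤ) D)
  (D-addMin : AddMinL (u + + 2) (n - 1ℤ) D)
  where

  C' C'' D' A Middle T : List ℤ
  C' = + 0 ∷ C
  C'' = C ++ + 0 ∷ []
  D' = D ++ n ∷ []
  A = C' ++ D'
  Middle = interval (u + + 2) (n + u)
  T = C' ++ Middle ++ shift n D'

  n-1<n : n - 1ℤ < n
  n-1<n = <-by (0≤+ 0) (solve (n ∷ []))

  u+1≤u+2 : u + 1ℤ ≤ u + + 2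
  u+1≤u+2 = ≤-by (0≤+ 1) (solve (u ∷ []))

  u+2≤n : u + + 2 ≤ n
  u+2≤n = ≤-by (≤⇒0≤ u≤n-6 ⊕ 0≤+ 4) (solve (n ∷ u ∷ []))

  u+2≤n+u+1 : u + + 2 ≤ n + u + 1ℤ
  u+2≤n+u+1 = ≤-by (≤⇒0≤ u≤n-6 ⊕ ≤⇒0≤ 4≤u ⊕ 0≤+ 9) (solve (n ∷ u ∷ []))

  D-long : (n - 1ℤ) - (u + + 2) > 1ℤ
  D-long = <-by (≤⇒0≤ u≤n-6 ⊕ 0≤+ 1) (solve (n ∷ u ∷ []))

  C'⊆[0,u] : ∀ {x} → x ∈ C' → InIv (+ 0) u x
  C'⊆[0,u] (here refl) = ≤-refl , ≤-by (≤⇒0≤ 4≤u ⊕ 0≤+ 4) (solve (u ∷ []))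
  C'⊆[0,u] (there x∈C) = let 1≤x , x≤u = C⊆[1,u] _ x∈C in ≤-trans (0≤+ 1) 1≤x , x≤u

  D'⊆[u+2,n] : ∀ {x} → x ∈ D' → InIv (u + + 2) n x
  D'⊆[u+2,n] x∈D' with ∈-++⁻ D x∈D'
  ... | inj₁ x∈D = let u+2≤x , x≤n-1 = D⊆[u+2,n-1] _ x∈D in u+2≤x , ≤-trans x≤n-1 (<⇒≤ n-1<n)
  ... | inj₂ (here refl) = u+2≤n , ≤-refl

  C'⊆C'' : C' ⊆ C''
  C'⊆C'' (here refl) = ∈-++⁺ʳ C (here refl)
  C'⊆C'' (there x∈C) = ∈-++⁺ˡ x∈C

  C''⊆C' : C'' ⊆ C'
  C''⊆C' = [ there , (λ { (here refl) → here refl }) ] ∘ ∈-++⁻ C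

  C'⊆A : C' ⊆ A
  C'⊆A = ∈-++⁺ˡ

  D'⊆A : D' ⊆ A
  D'⊆A = ∈-++⁺ʳ C'

  D'-addMin : ∀ t → (t ∈ twice D') ⇔ (InIv (+ 2 * (u + + 2)) (u + + 2 + (n - 1ℤ) - 1ℤ) t ⊎ t ∈ shift n D')
  D'-addMin = subst P n-1+1≡n D-addMin
    where
    P : ℤ → Set
    P m = ∀ t → (t ∈ twice (D ++ m ∷ [])) ⇔
                (InIv (+ 2 * (u + + 2)) (u + + 2 + (n - 1ℤ) - 1ℤ) t ⊎ t ∈ shift m (D ++ m ∷ []))
    n-1+1≡n : n - 1ℤ + 1ℤ ≡ n
    n-1+1≡n = solve (n ∷ [])

  Middle⊆T : ∀ {t} → u + + 2 ≤ t → t ≤ n + u → t ∈ T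
  Middle⊆T u+2≤t t≤n+u = ∈-++⁺ʳ C' (∈-++⁺ˡ (∈-interval⁺ (u + + 2) (n + u) (u+2≤t , t≤n+u)))

  twiceC''⊆T : twice C'' ⊆ T
  twiceC''⊆T {t} t∈2C'' with Equivalence.to (C-addMin t) t∈2C''
  ... | inj₁ (1+u+1≤t , t≤2u) = Middle⊆T (≤-trans u+2≤1+u+1 1+u+1≤t) (≤-trans t≤2u 2u≤n+u)
    where
    u+2≤1+u+1 : u + + 2 ≤ 1ℤ + u + 1ℤ
    u+2≤1+u+1 = ≤-reflexive (solve (u ∷ []))
    2u≤n+u : + 2 * u ≤ n + u
    2u≤n+u = ≤-by (≤⇒0≤ u≤n-6 ⊕ 0≤+ 6) (solve (n ∷ u ∷ []))
  ... | inj₂ t∈0+C'' with c , c∈C'' , refl ← ∈-map⁻ (_+_ (+ 0)) t∈0+C'' =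
    ∈-++⁺ˡ (subst (_∈ C') (sym (+-identityˡ c)) (C''⊆C' c∈C''))

  C'+D'⊆T : ∀ {x y} → x ∈ C' → y ∈ D' → x + y ∈ T
  C'+D'⊆T {x} {y} x∈C' y∈D' = Middle⊆T {x + y}
    (≤-by (≤⇒0≤ (proj₁ x∈[0,u]) ⊕ ≤⇒0≤ (proj₁ y∈[u+2,n])) (solve (x ∷ y ∷ u ∷ [])))
    (≤-by (≤⇒0≤ (proj₂ x∈[0,u]) ⊕ ≤⇒0≤ (proj₂ y∈[u+2,n])) (solve (x ∷ y ∷ u ∷ n ∷ [])))
    where
    x∈[0,u] = C'⊆[0,u] x∈C'
    y∈[u+2,n] = D'⊆[u+2,n] y∈D'

  twiceD'⊆T : twice D' ⊆ T
  twiceD'⊆T {t} t∈2D' with Equivalence.to (D'-addMin t) t∈2D'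
  ... | inj₁ (2[u+2]≤t , t≤u+2+n-1-1) =
    Middle⊆T (≤-trans u+2≤2[u+2] 2[u+2]≤t) (≤-trans t≤u+2+n-1-1 (≤-reflexive (solve (n ∷ u ∷ []))))
    where
    u+2≤2[u+2] : u + + 2 ≤ + 2 * (u + + 2)
    u+2≤2[u+2] = ≤-by (≤⇒0≤ 4≤u ⊕ 0≤+ 6) (solve (u ∷ []))
  ... | inj₂ t∈n+D' = ∈-++⁺ʳ C' (∈-++⁺ʳ Middle t∈n+D')

  twice⊆T : twice A ⊆ T
  twice⊆T t∈2A with x , y , x∈A , y∈A , refl ← ∈-twice⁻ t∈2A with ∈-++⁻ C' x∈A | ∈-++⁻ C' y∈A
  ... | inj₁ x∈C' | inj₁ y∈C' = twiceC''⊆T (∈-twice⁺ (C'⊆C'' x∈C') (C'⊆C'' y∈C'))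
  ... | inj₁ x∈C' | inj₂ y∈D' = C'+D'⊆T x∈C' y∈D'
  ... | inj₂ x∈D' | inj₁ y∈C' = subst (_∈ T) (+-comm y x) (C'+D'⊆T y∈C' x∈D')
  ... | inj₂ x∈D' | inj₂ y∈D' = twiceD'⊆T (∈-twice⁺ x∈D' y∈D')

  u∈C : u ∈ C
  u∈C = rightDense⇒top∈ {x = u} C-dense
          (≤-by (≤⇒0≤ 4≤u ⊕ 0≤+ 2) (solve (u ∷ [])) , ≤-refl) (≤-by (0≤+ 1) (solve (u ∷ [])))

  u-1∈C : u - 1ℤ ∈ C
  u-1∈C = rightDense⇒top∈ {x = u - 1ℤ} C-dense
            (≤-by (≤⇒0≤ 4≤u ⊕ 0≤+ 1) (solve (u ∷ [])) , ≤-by (0≤+ 1) (solve (u ∷ []))) ≤-refl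

  u+2∈D : u + + 2 ∈ D
  u+2∈D = proj₁ (leftDense⇒ends (u + + 2) (n - 1ℤ) D D-dense D-long)

  u+3∈D : u + + 2 + 1ℤ ∈ D
  u+3∈D = proj₁ (proj₂ (leftDense⇒ends (u + + 2) (n - 1ℤ) D D-dense D-long))

  [u-1]+[u+2]≡2u+1 : (u - 1ℤ) + (u + + 2) ≡ + 2 * u + 1ℤ
  [u-1]+[u+2]≡2u+1 = solve (u ∷ [])

  u+[u+2]≡2u+2 : u + (u + + 2) ≡ + 2 * u + 1ℤ + 1ℤ
  u+[u+2]≡2u+2 = solve (u ∷ [])

  u+[u+3]≡2u+3 : u + (u + + 2 + 1ℤ) ≡ + 2 * u + 1ℤ + 1ℤ + 1ℤ
  u+[u+3]≡2u+3 = solve (u ∷ [])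

  2u+3<⇒2[u+2]≤ : ∀ {t} → + 2 * u + 1ℤ + 1ℤ + 1ℤ < t → + 2 * (u + + 2) ≤ t
  2u+3<⇒2[u+2]≤ {t} 2u+3<t = ≤-by (<⇒0≤ 2u+3<t) (solve (u ∷ t ∷ []))

  ≤n+u⇒≤u+2+n-1-1 : ∀ {t} → t ≤ n + u → t ≤ u + + 2 + (n - 1ℤ) - 1ℤ
  ≤n+u⇒≤u+2+n-1-1 {t} t≤n+u = ≤-trans t≤n+u (≤-reflexive (solve (n ∷ u ∷ [])))

  above-2u⊆twice : ∀ {t} → + 2 * u < t → t ≤ n + u → t ∈ twice A
  above-2u⊆twice 2u<t t≤n+u with <⇒≡suc⊎suc< 2u<t
  ... | inj₁ refl = subst (_∈ twice A) [u-1]+[u+2]≡2u+1 (∈-twice⁺ (C'⊆A (there u-1∈C)) (D'⊆A (∈-++⁺ˡ u+2∈D)))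
  ... | inj₂ 2u+1<t with <⇒≡suc⊎suc< 2u+1<t
  ... | inj₁ refl = subst (_∈ twice A) u+[u+2]≡2u+2 (∈-twice⁺ (C'⊆A (there u∈C)) (D'⊆A (∈-++⁺ˡ u+2∈D)))
  ... | inj₂ 2u+2<t with <⇒≡suc⊎suc< 2u+2<t
  ... | inj₁ refl = subst (_∈ twice A) u+[u+3]≡2u+3 (∈-twice⁺ (C'⊆A (there u∈C)) (D'⊆A (∈-++⁺ˡ u+3∈D)))
  ... | inj₂ 2u+3<t = twice-mono {D'} D'⊆A
    (Equivalence.from (D'-addMin _) (inj₁ (2u+3<⇒2[u+2]≤ 2u+3<t , ≤n+u⇒≤u+2+n-1-1 t≤n+u)))

  Middle⊆twice : ∀ {t} → InIv (u + + 2) (n + u) t → t ∈ twice A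
  Middle⊆twice {t} (u+2≤t , t≤n+u) with t ≤? + 2 * u
  ... | yes t≤2u = twice-mono {C''} (C'⊆A ∘ C''⊆C')
    (Equivalence.from (C-addMin t) (inj₁ (≤-trans 1+u+1≤u+2 u+2≤t , t≤2u)))
    where
    1+u+1≤u+2 : 1ℤ + u + 1ℤ ≤ u + + 2
    1+u+1≤u+2 = ≤-reflexive (solve (u ∷ []))
  ... | no t≰2u = above-2u⊆twice (≰⇒> t≰2u) t≤n+u

  T⊆twice : T ⊆ twice A
  T⊆twice t∈T with ∈-++⁻ C' t∈T
  ... | inj₁ t∈C' = subst (_∈ twice A) (+-identityˡ _) (∈-twice⁺ (C'⊆A (here refl)) (C'⊆A t∈C'))
  ... | inj₂ t∈M++S with ∈-++⁻ Middle t∈M++S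
  ... | inj₁ t∈M = Middle⊆twice (∈-interval⁻ (u + + 2) (n + u) u+2≤n+u+1 t∈M)
  ... | inj₂ t∈S = twice-mono {D'} D'⊆A (∈⇒shift⊆twice (∈-++⁺ʳ D (here refl)) t∈S)

  C'<u+1 : ∀ {x} → x ∈ C' → x < u + 1ℤ
  C'<u+1 x∈C' = ≤-<-trans (proj₂ (C'⊆[0,u] x∈C')) (i<i+1 u)

  u+1≤D' : ∀ {x} → x ∈ D' → u + 1ℤ ≤ x
  u+1≤D' x∈D' = ≤-trans u+1≤u+2 (proj₁ (D'⊆[u+2,n] x∈D'))

  card-C' : card C' ≡ 1 ℕ.+ card C
  card-C' = card-++-separated {+ 0 ∷ []} 1ℤ (λ { (here refl) → i<i+1 (+ 0) })
                              (λ {x} x∈C → proj₁ (C⊆[1,u] x x∈C))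

  card-D' : card D' ≡ card D ℕ.+ 1
  card-D' = card-++-separated n (λ {x} x∈D → ≤-<-trans (proj₂ (D⊆[u+2,n-1] x x∈D)) n-1<n)
                              (λ { (here refl) → ≤-refl })

  card-A : card A ≡ card C' ℕ.+ card D'
  card-A = card-++-separated (u + 1ℤ) C'<u+1 u+1≤D'

  card-Middle : + card Middle ≡ n - 1ℤ
  card-Middle = trans (card-interval (u + + 2) (n + u) u+2≤n+u+1) length≡
    where
    length≡ : n + u - (u + + 2) + 1ℤ ≡ n - 1ℤ
    length≡ = solve (n ∷ u ∷ [])

  card-T : card T ≡ card C' ℕ.+ (card Middle ℕ.+ card D')
  card-T = begin
    card T
      ≡⟨ card-++-separated (u + 1ℤ) C'<u+1 u+1≤M++S ⟩
    card C' ℕ.+ card (Middle ++ shift n D')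
      ≡⟨ cong (card C' ℕ.+_) (card-++-separated (n + u + 1ℤ) M<n+u+1 n+u+1≤S) ⟩
    card C' ℕ.+ (card Middle ℕ.+ card (shift n D'))
      ≡⟨ cong (λ k → card C' ℕ.+ (card Middle ℕ.+ k)) (card-shift n D') ⟩
    card C' ℕ.+ (card Middle ℕ.+ card D')
      ∎
    where
    open ≡-Reasoning
    n+u+1≤n+d : ∀ {d} → u + + 2 ≤ d → n + u + 1ℤ ≤ n + d
    n+u+1≤n+d {d} u+2≤d = ≤-by (≤⇒0≤ u+2≤d ⊕ 0≤+ 1) (solve (n ∷ u ∷ d ∷ []))
    u+1≤n+u+1 : u + 1ℤ ≤ n + u + 1ℤ
    u+1≤n+u+1 = ≤-by (≤⇒0≤ u≤n-6 ⊕ ≤⇒0≤ 4≤u ⊕ 0≤+ 10) (solve (n ∷ u ∷ []))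
    n+u+1≤S : ∀ {y} → y ∈ shift n D' → n + u + 1ℤ ≤ y
    n+u+1≤S y∈S with d , d∈D' , refl ← ∈-map⁻ (_+_ n) y∈S = n+u+1≤n+d (proj₁ (D'⊆[u+2,n] d∈D'))
    M<n+u+1 : ∀ {y} → y ∈ Middle → y < n + u + 1ℤ
    M<n+u+1 y∈M = ≤-<-trans (proj₂ (∈-interval⁻ (u + + 2) (n + u) u+2≤n+u+1 y∈M)) (i<i+1 (n + u))
    u+1≤M++S : ∀ {y} → y ∈ Middle ++ shift n D' → u + 1ℤ ≤ y
    u+1≤M++S y∈M++S with ∈-++⁻ Middle y∈M++S
    ... | inj₁ y∈M = ≤-trans u+1≤u+2 (proj₁ (∈-interval⁻ (u + + 2) (n + u) u+2≤n+u+1 y∈M))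
    ... | inj₂ y∈S = ≤-trans u+1≤n+u+1 (n+u+1≤S y∈S)

  card-twice : + card (twice A) ≡ + 3 * + card A - + 3
  card-twice = begin
    + card (twice A)
      ≡⟨ cong +_ (trans (card-cong twice⊆T T⊆twice) card-T) ⟩
    + card C' + (+ card Middle + + card D')
      ≡⟨ cong₂ (λ c' m → c' + (m + + card D')) (cong +_ card-C') card-Middle ⟩
    1ℤ + + card C + (n - 1ℤ + + card D')
      ≡⟨ cong (λ d' → 1ℤ + + card C + (n - 1ℤ + d')) (cong +_ card-D') ⟩
    1ℤ + + card C + (n - 1ℤ + (+ card D + 1ℤ))
      ≡⟨ count (+ card C) (+ card D) 2|C| 2|D| ⟩
    + 3 * (1ℤ + + card C + (+ card D + 1ℤ)) - + 3
      ≡⟨ cong (λ a → + 3 * + a - + 3) (trans card-A (cong₂ ℕ._+_ card-C' card-D')) ⟨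
    + 3 * + card A - + 3
      ∎
    where
    open ≡-Reasoning
    2|C| : + card C + + card C ≡ u - 1ℤ + 1ℤ
    2|C| = Equivalence.to (halfDense⇔card C⊆[1,u]) (proj₁ C-dense)
    2|D| : + card D + + card D ≡ n - 1ℤ - (u + + 2) + 1ℤ
    2|D| = Equivalence.to (halfDense⇔card D⊆[u+2,n-1]) (proj₁ D-dense)
    count : ∀ c d → c + c ≡ u - 1ℤ + 1ℤ → d + d ≡ n - 1ℤ - (u + + 2) + 1ℤ →
            1ℤ + c + (n - 1ℤ + (d + 1ℤ)) ≡ + 3 * (1ℤ + c + (d + 1ℤ)) - + 3
    count c d 2c≡u 2d≡n-u-2 = begin
      1ℤ + c + (n - 1ℤ + (d + 1ℤ))
        ≡⟨ solve (n ∷ c ∷ d ∷ []) ⟩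
      + 3 * (1ℤ + c + (d + 1ℤ)) - + 3 - (c + c + (d + d) + + 2 - n)
        ≡⟨ cong₂ (λ p q → + 3 * (1ℤ + c + (d + 1ℤ)) - + 3 - (p + q + + 2 - n)) 2c≡u 2d≡n-u-2 ⟩
      + 3 * (1ℤ + c + (d + 1ℤ)) - + 3 - (u - 1ℤ + 1ℤ + (n - 1ℤ - (u + + 2) + 1ℤ) + + 2 - n)
        ≡⟨ solve (n ∷ u ∷ c ∷ d ∷ []) ⟩
      + 3 * (1ℤ + c + (d + 1ℤ)) - + 3
        ∎

proposition1p3 :
  (∀ (u v : ℤ) (B : List ℤ) → u ≤ v → SubIv u v B →
    (AntiSym u v B ⇔ (HalfDense u v B × ((u + v) ∉ twice B))))
  ×
  (∀ (u v : ℤ) (B : List ℤ) → u ≤ v → SubIv u v B →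
    LeftDense u v B → v - u > + 1 →
    (u ∈ B × (u + + 1) ∈ B × v ∉ B × (v - + 1) ∉ B))
  ×
  (∀ (u v : ℤ) (B : List ℤ) → u ≤ v → SubIv u v B →
    LeftDense u v B →
    ∀ t → (InIv (+ 2 * u) (u + v - + 1) t ⊎ (t ∈ shift (v + + 1) (B ++ (v + + 1 ∷ []))))
        → t ∈ twice (B ++ (v + + 1 ∷ [])))
  ×
  (∀ (u v : ℤ) (B : List ℤ) → u ≤ v → SubIv u v B →
    LeftDense u v B →
    ((+ card (twice (B ++ (v + + 1 ∷ []))) ≡ + 3 * + card (B ++ (v + + 1 ∷ [])) - + 3)
      ⇔ (AntiSym u v B × AddMinL u v B)))
  ×
  (∀ (u v : ℤ) (B : List ℤ) → u ≤ v → SubIv u v B →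
    LeftDense u v B →
    ((∀ x → (x ∈ B) ⇔ ((u ≤ x) × (+ 2 * x ≤ u + v - + 1))) ⊎
     (∀ (b : ℤ) → b > v + + 1 →
       + card (twice (B ++ (b ∷ []))) > + 3 * + card (B ++ (b ∷ [])) - + 3)))
  ×
  (∀ (n u : ℤ) (C D : List ℤ) → InIv (+ 4) (n - + 6) u →
    SubIv (+ 1) u C → RightDense (+ 1) u C → AntiSym (+ 1) u C → AddMinR (+ 1) u C →
    SubIv (u + + 2) (n - + 1) D → LeftDense (u + + 2) (n - + 1) D →
    AntiSym (u + + 2) (n - + 1) D → AddMinL (u + + 2) (n - + 1) D →
    + card (twice ((+ 0 ∷ C) ++ (D ++ (n ∷ []))))
      ≡ + 3 * + card ((+ 0 ∷ C) ++ (D ++ (n ∷ []))) - + 3)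
proposition1p3 =
  antiSym⇔halfDense∧∉twice ,
  (λ u v B _ _ → leftDense⇒ends u v B) ,
  (λ u v B _ _ → leftDense⇒sumset⊇ {u} {v} {B}) ,
  (λ u v B u≤v B⊆[u,v] B-dense → LeftDenseSumset.card-twice≡⇔antiSym∧addMin u≤v B⊆[u,v] B-dense) ,
  (λ u v B u≤v B⊆[u,v] B-dense → LeftDenseSumset.initialSegment⊎card> u≤v B⊆[u,v] B-dense) ,
  λ n u C D (4≤u , u≤n-6) C⊆[1,u] C-dense _ C-addMin D⊆[u+2,n-1] D-dense _ D-addMin →
    Concatenation.card-twice 4≤u u≤n-6 C⊆[1,u] C-dense C-addMin D⊆[u+2,n-1] D-dense D-addMin
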